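{- Let $G$ be a graph with vertices $v$ and $w$ such that $\mathrm{d}(v,w)\geq 3$ and there exists a path of length four from $v$ to $w$. Let $G':=\mathrm{vid}(G,[v,w])$. Then $\mathrm{rank}(\widetilde{H}_1(\mathcal{N}(G')))\leq \mathrm{rank}(\widetilde{H}_1(\mathcal{N}(G)))$.
   Context: Graphs are finite and simple; $\mathrm{d}$ is graph distance; a path of length four has four edges and distinct vertices. $\mathrm{vid}(G,[v,w])$ identifies the nonadjacent vertices $v,w$ into one vertex, ignoring multiple edges. The neighborhood complex $\mathcal{N}(G)$ is the simplicial complex on $V(G)$ whose faces are all subsets of the sets $N_G(u)$, $u\in V(G)$, where $N_G(u)$ is the neighbor set of $u$. $\widetilde{H}_1$ denotes reduced first simplicial homology. -}

module Defs where

open import Data.Nat using (ℕ; zero; suc; _<_)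
open import Data.Fin using (Fin; zero; suc; inject₁; fromℕ; punchIn; _≟_) renaming (_<_ to _<ᶠ_)
open import Data.Bool using (Bool; true; false; _∨_; _∧_; T; if_then_else_)
open import Data.Integer using (ℤ; 0ℤ; _+_; _*_; -_)
open import Data.List using (List; []; _∷_; map; foldr; concatMap; concat; allFin)
open import Data.List.Relation.Unary.All using (All)
open import Data.Vec using (Vec; lookup)
open import Data.Product using (Σ; ∃; _×_; _,_; proj₂)
open import Function.Definitions using (Injective)
open import Relation.Nullary using (¬_; does)
open import Relation.Binary.PropositionalEquality using (_≡_)

Graph : ℕ → Set
Graph n = Fin n → Fin n → Bool

Adj : ∀ {n} → Graph n → Fin n → Fin n → Set
Adj G a b = T (G a b)

IsSimple : ∀ {n} → Graph n → Set
IsSimple G = (∀ a b → G a b ≡ G b a) × (∀ a → G a a ≡ false)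

Walk : ∀ {n} → Graph n → ℕ → Fin n → Fin n → Set
Walk {n} G k u v = Σ (Vec (Fin n) (suc k)) λ p →
  (lookup p zero ≡ u) × (lookup p (fromℕ k) ≡ v) ×
  (∀ (i : Fin k) → Adj G (lookup p (inject₁ i)) (lookup p (suc i)))

Path : ∀ {n} → Graph n → ℕ → Fin n → Fin n → Set
Path {n} G k u v = Σ (Vec (Fin n) (suc k)) λ p →
  (lookup p zero ≡ u) × (lookup p (fromℕ k) ≡ v) ×
  (∀ (i : Fin k) → Adj G (lookup p (inject₁ i)) (lookup p (suc i))) ×
  Injective _≡_ _≡_ (lookup p)

DistAtLeast : ∀ {n} → Graph n → ℕ → Fin n → Fin n → Set
DistAtLeast G m u v = ∀ k → k < m → ¬ Walk G k u v

-- vertex identification vid(G,[v,w]) : the vertex w is deleted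
-- (vertices of G' are Fin n, embedded into Fin (suc n) by punchIn w)
-- and its neighbours become neighbours of v.

eqb : ∀ {n} → Fin n → Fin n → Bool
eqb a b = does (a ≟ b)

vid : ∀ {n} → Graph (suc n) → Fin (suc n) → Fin (suc n) → Graph n
vid G v w a b =
  G (punchIn w a) (punchIn w b)
  ∨ (eqb (punchIn w a) v ∧ G w (punchIn w b))
  ∨ (eqb (punchIn w b) v ∧ G (punchIn w a) w)

Complex : ℕ → Set₁
Complex n = List (Fin n) → Set

𝒩 : ∀ {n} → Graph n → Complex n
𝒩 {n} G s = Σ (Fin n) λ u → All (λ x → Adj G u x) s

-- Simplicial chains with integer coefficients (formal sums, oriented
-- simplices written with increasing vertices).

C0 C1 C2 : ℕ → Set
C0 n = List (ℤ × Fin n)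
C1 n = List (ℤ × (Fin n × Fin n))
C2 n = List (ℤ × (Fin n × Fin n × Fin n))

Edge : ∀ {n} → Complex n → Fin n × Fin n → Set
Edge K (a , b) = (a <ᶠ b) × K (a ∷ b ∷ [])

Tri : ∀ {n} → Complex n → Fin n × Fin n × Fin n → Set
Tri K (a , b , c) = (a <ᶠ b) × (b <ᶠ c) × K (a ∷ b ∷ c ∷ [])

∂₁ : ∀ {n} → C1 n → C0 n
∂₁ = concatMap λ { (z , (a , b)) → (z , b) ∷ (- z , a) ∷ [] }

∂₂ : ∀ {n} → C2 n → C1 n
∂₂ = concatMap λ { (z , (a , b , c)) →
        (z , (b , c)) ∷ (- z , (a , c)) ∷ (z , (a , b)) ∷ [] }

sumℤ : List ℤ → ℤ
sumℤ = foldr _+_ 0ℤ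

coef0 : ∀ {n} → C0 n → Fin n → ℤ
coef0 c x = sumℤ (map (λ { (z , y) → if eqb y x then z else 0ℤ }) c)

coef1 : ∀ {n} → C1 n → Fin n × Fin n → ℤ
coef1 c (a , b) =
  sumℤ (map (λ { (z , (a' , b')) → if eqb a' a ∧ eqb b' b then z else 0ℤ }) c)

_≈₁_ : ∀ {n} → C1 n → C1 n → Set
c ≈₁ d = ∀ σ → coef1 c σ ≡ coef1 d σ

IsCycle₁ : ∀ {n} → Complex n → C1 n → Set
IsCycle₁ K c = All (λ e → Edge K (proj₂ e)) c × (∀ x → coef0 (∂₁ c) x ≡ 0ℤ)

IsBoundary₁ : ∀ {n} → Complex n → C1 n → Set
IsBoundary₁ {n} K c = Σ (C2 n) λ d → All (λ t → Tri K (proj₂ t)) d × (∂₂ d ≈₁ c)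

scale : ∀ {n} → ℤ → C1 n → C1 n
scale l = map λ { (z , σ) → (l * z , σ) }

lincomb : ∀ {n k} → (Fin k → ℤ) → (Fin k → C1 n) → C1 n
lincomb {k = k} l zs = concat (map (λ i → scale (l i) (zs i)) (allFin k))

-- 1-cycles z₁,…,z_k whose homology classes are ℤ-linearly independent
-- in H₁(K) (= reduced H̃₁(K))
H1Independent : ∀ {n} → Complex n → (k : ℕ) → (Fin k → C1 n) → Set
H1Independent K k zs =
  (∀ i → IsCycle₁ K (zs i)) ×
  (∀ (l : Fin k → ℤ) → IsBoundary₁ K (lincomb l zs) → ∀ i → l i ≡ 0ℤ)

H1RankAtLeast : ∀ {n} → Complex n → ℕ → Set
H1RankAtLeast {n} K k = Σ (Fin k → C1 n) λ zs → H1Independent K k zs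

H1Rank≤ : ∀ {m n} → Complex m → Complex n → Set
H1Rank≤ K L = ∀ k → H1RankAtLeast K k → H1RankAtLeast L k

-- Collapsing w onto v is a graph homomorphism G → G' = vid(G,[v,w]), so it
-- induces a chain map from 𝒩(G) to 𝒩(G').  Conversely, every edge {x,y} of
-- 𝒩(G') lifts to a 1-chain of 𝒩(G) from x to y whose image is [x,y] plus a
-- boundary; extended linearly, cycles lift to cycles whose images are homologous
-- to the originals, so a boundary relation among the lifts yields one among
-- the originals and independent classes lift to independent classes.
--
-- The lifts come from the path v–a–b–c–w.  Let x, y have a common neighbour u
-- in G'.  If u ≠ v, each of x, y is either adjacent to u in G, or it is v, u is
-- adjacent to w, and v is joined to w by the chain v→b→w (a is a common
-- neighbour of v and b, c one of b and w), which collapses to zero.  If u = v,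
-- each of x, y is adjacent in G to v or to w, so it shares a neighbour with a
-- or with c, and a, c share the neighbour b; since x, y and the images of a
-- and c all lie in N_G'(v), the collapsed loop through them bounds two
-- triangles of 𝒩(G').
-- The hypothesis d(v,w) ≥ 3 only serves to exclude v = w and vw ∈ E(G).

module Submission where

open import Defs
open import Data.Bool using (true; false; _∧_; T; if_then_else_)
open import Data.Bool.Properties using (T-≡; T-∧; T-∨)
open import Data.Empty using (⊥-elim)
open import Data.Fin using (Fin; zero; suc; punchIn; punchOut; _≟_) renaming (_<_ to _<ᶠ_)
open import Data.Fin.Properties using (<-cmp; <-irrefl; <-trans; punchInᵢ≢i; punchIn-punchOut; punchOut-punchIn; punchIn-injective; punchOut-cong)
open import Data.Integer using (ℤ; 0ℤ; 1ℤ; -1ℤ; _+_; _*_; -_; _-_)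
open import Data.Integer.Properties using (+-*-semiring; +-identityˡ; +-identityʳ; +-assoc; *-identityʳ; *-zeroʳ; *-identityˡ; +-inverseʳ; -1*i≡-i; neg-involutive; *-distribˡ-+)
open import Algebra.Properties.Semiring.Sum +-*-semiring using (sum; sum-cong-≗; ∑-distrib-+; *-distribˡ-sum; sum-replicate-zero)
open import Data.Integer.Solver using (module +-*-Solver)
open import Data.List using (List; []; _∷_; _++_; map; concat; concatMap; allFin; tabulate)
open import Data.List.Properties using (map-tabulate)
open import Data.List.Relation.Unary.All using (All; []; _∷_)
open import Data.List.Relation.Unary.All.Properties using (++⁺; map⁺; concat⁺; tabulate⁺)
open import Data.Nat using (zero; suc; s≤s; z≤n)
open import Data.Product using (_×_; _,_; proj₁; proj₂)
open import Data.Sum using (_⊎_; inj₁; inj₂)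
open import Data.Vec using (lookup; []; _∷_)
open import Function using (id; _∘_; Equivalence)
open import Relation.Binary.Definitions using (tri<; tri≈; tri>)
open import Relation.Binary.PropositionalEquality using (_≡_; _≢_; refl; sym; trans; cong; cong₂; subst; subst₂; module ≡-Reasoning)
open import Relation.Nullary using (¬_; yes; no)
open import Relation.Nullary.Decidable using (dec-true; dec-false)

open +-*-Solver

-- Coefficients of chains

δ : ∀ {m} → Fin m → Fin m → ℤ
δ a b = if eqb a b then 1ℤ else 0ℤ

δ₁ : ∀ {m} → Fin m × Fin m → Fin m × Fin m → ℤ
δ₁ (a , b) (s , t) = if eqb a s ∧ eqb b t then 1ℤ else 0ℤ

δ₁≡δ*δ : ∀ {m} (a b s t : Fin m) → δ₁ (a , b) (s , t) ≡ δ a s * δ b t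
δ₁≡δ*δ a b s t with eqb a s | eqb b t
... | true  | true  = refl
... | true  | false = refl
... | false | _     = refl

if-then-0 : ∀ B (z : ℤ) → (if B then z else 0ℤ) ≡ z * (if B then 1ℤ else 0ℤ)
if-then-0 true  z = sym (*-identityʳ z)
if-then-0 false z = sym (*-zeroʳ z)

*-distribˡ-entry : ∀ l z D R → l * z * D + l * R ≡ l * (z * D + R)
*-distribˡ-entry = solve 4 (λ l z D R → l :* z :* D :+ l :* R := l :* (z :* D :+ R)) refl

-1*-cancel-neg : ∀ {x y z} → x ≡ -1ℤ * y → y ≡ - z → x ≡ z
-1*-cancel-neg {z = z} refl refl = trans (-1*i≡-i (- z)) (neg-involutive z)

coef0-++ : ∀ {m} (c d : C0 m) x → coef0 (c ++ d) x ≡ coef0 c x + coef0 d x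
coef0-++ []            d x = sym (+-identityˡ _)
coef0-++ ((z , a) ∷ c) d x = trans (cong (h +_) (coef0-++ c d x)) (sym (+-assoc h _ _))
  where h = if eqb a x then z else 0ℤ

coef1-++ : ∀ {m} (c d : C1 m) τ → coef1 (c ++ d) τ ≡ coef1 c τ + coef1 d τ
coef1-++ []                  d τ       = sym (+-identityˡ _)
coef1-++ ((z , (a , b)) ∷ c) d (s , t) = trans (cong (h +_) (coef1-++ c d (s , t))) (sym (+-assoc h _ _))
  where h = if eqb a s ∧ eqb b t then z else 0ℤ

coef0-∷ : ∀ {m} z (a : Fin m) c x → coef0 ((z , a) ∷ c) x ≡ z * δ a x + coef0 c x
coef0-∷ z a c x = cong (_+ coef0 c x) (if-then-0 (eqb a x) z)

coef1-∷ : ∀ {m} z (σ : Fin m × Fin m) c τ → coef1 ((z , σ) ∷ c) τ ≡ z * δ₁ σ τ + coef1 c τ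
coef1-∷ z (a , b) c (s , t) = cong (_+ coef1 c (s , t)) (if-then-0 (eqb a s ∧ eqb b t) z)

coef0-∂₁-∷ : ∀ {m} z (a b : Fin m) c x →
  coef0 (∂₁ ((z , (a , b)) ∷ c)) x ≡ z * (δ b x - δ a x) + coef0 (∂₁ c) x
coef0-∂₁-∷ z a b c x = begin
  coef0 ((z , b) ∷ (- z , a) ∷ ∂₁ c) x            ≡⟨ coef0-∷ z b ((- z , a) ∷ ∂₁ c) x ⟩
  z * δ b x + coef0 ((- z , a) ∷ ∂₁ c) x          ≡⟨ cong (z * δ b x +_) (coef0-∷ (- z) a (∂₁ c) x) ⟩
  z * δ b x + (- z * δ a x + coef0 (∂₁ c) x)      ≡⟨ solve 4 (λ z B A R → z :* B :+ (:- z :* A :+ R) := z :* (B :- A) :+ R)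
                                                        refl z (δ b x) (δ a x) (coef0 (∂₁ c) x) ⟩
  z * (δ b x - δ a x) + coef0 (∂₁ c) x            ∎
  where open ≡-Reasoning

coef1-∂₂-∷ : ∀ {m} z (a b c : Fin m) d τ →
  coef1 (∂₂ ((z , (a , b , c)) ∷ d)) τ ≡
  z * (δ₁ (b , c) τ - δ₁ (a , c) τ + δ₁ (a , b) τ) + coef1 (∂₂ d) τ
coef1-∂₂-∷ z a b c d τ = begin
  coef1 ((z , (b , c)) ∷ (- z , (a , c)) ∷ (z , (a , b)) ∷ ∂₂ d) τ
    ≡⟨ coef1-∷ z (b , c) ((- z , (a , c)) ∷ (z , (a , b)) ∷ ∂₂ d) τ ⟩
  z * BC + coef1 ((- z , (a , c)) ∷ (z , (a , b)) ∷ ∂₂ d) τ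
    ≡⟨ cong (z * BC +_) (coef1-∷ (- z) (a , c) ((z , (a , b)) ∷ ∂₂ d) τ) ⟩
  z * BC + (- z * AC + coef1 ((z , (a , b)) ∷ ∂₂ d) τ)
    ≡⟨ cong (λ r → z * BC + (- z * AC + r)) (coef1-∷ z (a , b) (∂₂ d) τ) ⟩
  z * BC + (- z * AC + (z * AB + coef1 (∂₂ d) τ))
    ≡⟨ solve 5 (λ z BC AC AB R → z :* BC :+ (:- z :* AC :+ (z :* AB :+ R)) := z :* (BC :- AC :+ AB) :+ R)
         refl z BC AC AB (coef1 (∂₂ d) τ) ⟩
  z * (BC - AC + AB) + coef1 (∂₂ d) τ ∎
  where
  open ≡-Reasoning
  BC AC AB : ℤ
  BC = δ₁ (b , c) τ
  AC = δ₁ (a , c) τ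
  AB = δ₁ (a , b) τ

coef1-scale : ∀ {m} l (c : C1 m) τ → coef1 (scale l c) τ ≡ l * coef1 c τ
coef1-scale l [] τ = sym (*-zeroʳ l)
coef1-scale l ((z , σ) ∷ c) τ = begin
  coef1 ((l * z , σ) ∷ scale l c) τ     ≡⟨ coef1-∷ (l * z) σ (scale l c) τ ⟩
  l * z * δ₁ σ τ + coef1 (scale l c) τ  ≡⟨ cong (l * z * δ₁ σ τ +_) (coef1-scale l c τ) ⟩
  l * z * δ₁ σ τ + l * coef1 c τ        ≡⟨ *-distribˡ-entry l z (δ₁ σ τ) _ ⟩
  l * (z * δ₁ σ τ + coef1 c τ)          ≡⟨ cong (l *_) (coef1-∷ z σ c τ) ⟨
  l * coef1 ((z , σ) ∷ c) τ             ∎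
  where open ≡-Reasoning

coef0-∂₁-scale : ∀ {m} l (c : C1 m) x → coef0 (∂₁ (scale l c)) x ≡ l * coef0 (∂₁ c) x
coef0-∂₁-scale l [] x = sym (*-zeroʳ l)
coef0-∂₁-scale l ((z , (a , b)) ∷ c) x = begin
  coef0 (∂₁ ((l * z , (a , b)) ∷ scale l c)) x      ≡⟨ coef0-∂₁-∷ (l * z) a b (scale l c) x ⟩
  l * z * D + coef0 (∂₁ (scale l c)) x              ≡⟨ cong (l * z * D +_) (coef0-∂₁-scale l c x) ⟩
  l * z * D + l * coef0 (∂₁ c) x                    ≡⟨ *-distribˡ-entry l z D _ ⟩
  l * (z * D + coef0 (∂₁ c) x)                      ≡⟨ cong (l *_) (coef0-∂₁-∷ z a b c x) ⟨
  l * coef0 (∂₁ ((z , (a , b)) ∷ c)) x              ∎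
  where
  open ≡-Reasoning
  D : ℤ
  D = δ b x - δ a x

scale₂ : ∀ {m} → ℤ → C2 m → C2 m
scale₂ l = map λ { (z , t) → (l * z , t) }

coef1-∂₂-scale₂ : ∀ {m} l (d : C2 m) τ → coef1 (∂₂ (scale₂ l d)) τ ≡ l * coef1 (∂₂ d) τ
coef1-∂₂-scale₂ l [] τ = sym (*-zeroʳ l)
coef1-∂₂-scale₂ l ((z , (a , b , c)) ∷ d) τ = begin
  coef1 (∂₂ ((l * z , (a , b , c)) ∷ scale₂ l d)) τ  ≡⟨ coef1-∂₂-∷ (l * z) a b c (scale₂ l d) τ ⟩
  l * z * D + coef1 (∂₂ (scale₂ l d)) τ              ≡⟨ cong (l * z * D +_) (coef1-∂₂-scale₂ l d τ) ⟩
  l * z * D + l * coef1 (∂₂ d) τ                     ≡⟨ *-distribˡ-entry l z D _ ⟩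
  l * (z * D + coef1 (∂₂ d) τ)                       ≡⟨ cong (l *_) (coef1-∂₂-∷ z a b c d τ) ⟨
  l * coef1 (∂₂ ((z , (a , b , c)) ∷ d)) τ           ∎
  where
  open ≡-Reasoning
  D : ℤ
  D = δ₁ (b , c) τ - δ₁ (a , c) τ + δ₁ (a , b) τ

∂₁-++ : ∀ {m} (c d : C1 m) → ∂₁ (c ++ d) ≡ ∂₁ c ++ ∂₁ d
∂₁-++ []                  d = refl
∂₁-++ ((z , (a , b)) ∷ c) d = cong (λ r → (z , b) ∷ (- z , a) ∷ r) (∂₁-++ c d)

∂₂-++ : ∀ {m} (c d : C2 m) → ∂₂ (c ++ d) ≡ ∂₂ c ++ ∂₂ d
∂₂-++ []                      d = refl
∂₂-++ ((z , (a , b , c)) ∷ e) d =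
  cong (λ r → (z , (b , c)) ∷ (- z , (a , c)) ∷ (z , (a , b)) ∷ r) (∂₂-++ e d)

coef0-∂₁-++ : ∀ {m} (c d : C1 m) x → coef0 (∂₁ (c ++ d)) x ≡ coef0 (∂₁ c) x + coef0 (∂₁ d) x
coef0-∂₁-++ c d x = trans (cong (λ e → coef0 e x) (∂₁-++ c d)) (coef0-++ (∂₁ c) (∂₁ d) x)

coef1-∂₂-++ : ∀ {m} (c d : C2 m) τ → coef1 (∂₂ (c ++ d)) τ ≡ coef1 (∂₂ c) τ + coef1 (∂₂ d) τ
coef1-∂₂-++ c d τ = trans (cong (λ e → coef1 e τ) (∂₂-++ c d)) (coef1-++ (∂₂ c) (∂₂ d) τ)

sum-δ : ∀ {m} (a : Fin m) (F : Fin m → ℤ) → sum (λ s → δ a s * F s) ≡ F a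
sum-δ {suc m} zero    F = trans (cong₂ _+_ (*-identityˡ (F zero)) (sum-replicate-zero m)) (+-identityʳ (F zero))
sum-δ {suc m} (suc a) F = trans (+-identityˡ _) (sum-δ a (F ∘ suc))

-- Chains are lists of entries, not normal forms, so a map defined entrywise
-- must be shown to respect ≈₁; pairing with a cochain is how this is done.
⟨_∣_⟩ : ∀ {m} → C1 m → (Fin m → Fin m → ℤ) → ℤ
⟨ c ∣ K ⟩ = sum λ s → sum λ t → coef1 c (s , t) * K s t

⟨[]∣⟩ : ∀ {m} (K : Fin m → Fin m → ℤ) → ⟨ [] ∣ K ⟩ ≡ 0ℤ
⟨[]∣⟩ {m} K = begin
  sum {m} (λ _ → sum {m} λ _ → 0ℤ)
    ≡⟨ sum-cong-≗ {m} {λ _ → sum {m} λ _ → 0ℤ} {λ _ → 0ℤ} (λ _ → sum-replicate-zero m) ⟩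
  sum {m} (λ _ → 0ℤ)
    ≡⟨ sum-replicate-zero m ⟩
  0ℤ ∎
  where open ≡-Reasoning

⟨∷∣⟩ : ∀ {m} z (a b : Fin m) c K → ⟨ (z , (a , b)) ∷ c ∣ K ⟩ ≡ z * K a b + ⟨ c ∣ K ⟩
⟨∷∣⟩ z a b c K = begin
  ⟨ (z , (a , b)) ∷ c ∣ K ⟩
    ≡⟨ sum-cong-≗ (λ s → sum-cong-≗ (λ t → split s t)) ⟩
  sum (λ s → sum λ t → δ a s * (δ b t * (z * K s t)) + coef1 c (s , t) * K s t)
    ≡⟨ sum-cong-≗ (λ s → ∑-distrib-+ (λ t → δ a s * (δ b t * (z * K s t))) _) ⟩
  sum (λ s → sum (λ t → δ a s * (δ b t * (z * K s t))) + sum λ t → coef1 c (s , t) * K s t)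
    ≡⟨ ∑-distrib-+ (λ s → sum λ t → δ a s * (δ b t * (z * K s t))) _ ⟩
  sum (λ s → sum λ t → δ a s * (δ b t * (z * K s t))) + ⟨ c ∣ K ⟩
    ≡⟨ cong (_+ ⟨ c ∣ K ⟩) (sum-cong-≗ (λ s → *-distribˡ-sum (δ a s) (λ t → δ b t * (z * K s t)))) ⟨
  sum (λ s → δ a s * sum λ t → δ b t * (z * K s t)) + ⟨ c ∣ K ⟩
    ≡⟨ cong (_+ ⟨ c ∣ K ⟩) (trans (sum-δ a _) (sum-δ b _)) ⟩
  z * K a b + ⟨ c ∣ K ⟩ ∎
  where
  open ≡-Reasoning
  split : ∀ s t → coef1 ((z , (a , b)) ∷ c) (s , t) * K s t ≡
                  δ a s * (δ b t * (z * K s t)) + coef1 c (s , t) * K s t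
  split s t rewrite coef1-∷ z (a , b) c (s , t) | δ₁≡δ*δ a b s t =
    solve 5 (λ z A B C K → (z :* (A :* B) :+ C) :* K := A :* (B :* (z :* K)) :+ C :* K)
      refl z (δ a s) (δ b t) (coef1 c (s , t)) (K s t)

extend : ∀ {m m'} → (Fin m × Fin m → C1 m') → C1 m → C1 m'
extend h = concatMap λ { (z , σ) → scale z (h σ) }

coef1-extend-∷ : ∀ {m m'} (h : Fin m × Fin m → C1 m') z σ c τ →
  coef1 (extend h ((z , σ) ∷ c)) τ ≡ z * coef1 (h σ) τ + coef1 (extend h c) τ
coef1-extend-∷ h z σ c τ =
  trans (coef1-++ (scale z (h σ)) (extend h c) τ) (cong (_+ coef1 (extend h c) τ) (coef1-scale z (h σ) τ))

coef1-extend-single : ∀ {m m'} (h : Fin m × Fin m → C1 m') z σ τ →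
  coef1 (extend h ((z , σ) ∷ [])) τ ≡ z * coef1 (h σ) τ
coef1-extend-single h z σ τ = trans (coef1-extend-∷ h z σ [] τ) (+-identityʳ _)

coef1-extend : ∀ {m m'} (h : Fin m × Fin m → C1 m') c τ →
  coef1 (extend h c) τ ≡ ⟨ c ∣ (λ s t → coef1 (h (s , t)) τ) ⟩
coef1-extend h [] τ = sym (⟨[]∣⟩ λ s t → coef1 (h (s , t)) τ)
coef1-extend h ((z , (a , b)) ∷ c) τ =
  trans (coef1-extend-∷ h z (a , b) c τ)
        (trans (cong (z * coef1 (h (a , b)) τ +_) (coef1-extend h c τ)) (sym (⟨∷∣⟩ z a b c _)))

extend-resp-≈₁ : ∀ {m m'} (h : Fin m × Fin m → C1 m') {c c'} → c ≈₁ c' → extend h c ≈₁ extend h c'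
extend-resp-≈₁ {m} h {c} {c'} c≈c' τ = begin
  coef1 (extend h c) τ   ≡⟨ coef1-extend h c τ ⟩
  ⟨ c ∣ K ⟩              ≡⟨ sum-cong-≗ (λ s → sum-cong-≗ (λ t → cong (_* K s t) (c≈c' (s , t)))) ⟩
  ⟨ c' ∣ K ⟩             ≡⟨ coef1-extend h c' τ ⟨
  coef1 (extend h c') τ  ∎
  where
  open ≡-Reasoning
  K : Fin m → Fin m → ℤ
  K = λ s t → coef1 (h (s , t)) τ

coef1-extend-++ : ∀ {m m'} (h : Fin m × Fin m → C1 m') c d τ →
  coef1 (extend h (c ++ d)) τ ≡ coef1 (extend h c) τ + coef1 (extend h d) τ
coef1-extend-++ h [] d τ = sym (+-identityˡ _)
coef1-extend-++ h ((z , σ) ∷ c) d τ = begin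
  coef1 (extend h ((z , σ) ∷ c ++ d)) τ                 ≡⟨ coef1-extend-∷ h z σ (c ++ d) τ ⟩
  z * H + coef1 (extend h (c ++ d)) τ                   ≡⟨ cong (z * H +_) (coef1-extend-++ h c d τ) ⟩
  z * H + (coef1 (extend h c) τ + coef1 (extend h d) τ) ≡⟨ +-assoc (z * H) _ _ ⟨
  z * H + coef1 (extend h c) τ + coef1 (extend h d) τ   ≡⟨ cong (_+ coef1 (extend h d) τ) (coef1-extend-∷ h z σ c τ) ⟨
  coef1 (extend h ((z , σ) ∷ c)) τ + coef1 (extend h d) τ ∎
  where
  open ≡-Reasoning
  H : ℤ
  H = coef1 (h σ) τ

coef1-extend-scale : ∀ {m m'} (h : Fin m × Fin m → C1 m') l c τ →
  coef1 (extend h (scale l c)) τ ≡ l * coef1 (extend h c) τ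
coef1-extend-scale h l [] τ = sym (*-zeroʳ l)
coef1-extend-scale h l ((z , σ) ∷ c) τ = begin
  coef1 (extend h ((l * z , σ) ∷ scale l c)) τ        ≡⟨ coef1-extend-∷ h (l * z) σ (scale l c) τ ⟩
  l * z * H + coef1 (extend h (scale l c)) τ          ≡⟨ cong (l * z * H +_) (coef1-extend-scale h l c τ) ⟩
  l * z * H + l * coef1 (extend h c) τ                ≡⟨ *-distribˡ-entry l z H _ ⟩
  l * (z * H + coef1 (extend h c) τ)                  ≡⟨ cong (l *_) (coef1-extend-∷ h z σ c τ) ⟨
  l * coef1 (extend h ((z , σ) ∷ c)) τ                ∎
  where
  open ≡-Reasoning
  H : ℤ
  H = coef1 (h σ) τ

-- Oriented simplices

opaque
  ⟪_,_⟫ : ∀ {m} → Fin m → Fin m → C1 m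
  ⟪ p , q ⟫ with <-cmp p q
  ... | tri< _ _ _ = (1ℤ , (p , q)) ∷ []
  ... | tri≈ _ _ _ = []
  ... | tri> _ _ _ = (-1ℤ , (q , p)) ∷ []

  ⟪⟫-< : ∀ {m} {p q : Fin m} → p <ᶠ q → ⟪ p , q ⟫ ≡ (1ℤ , (p , q)) ∷ []
  ⟪⟫-< {p = p} {q} p<q with <-cmp p q
  ... | tri< _ _ _   = refl
  ... | tri≈ p≮q _ _ = ⊥-elim (p≮q p<q)
  ... | tri> p≮q _ _ = ⊥-elim (p≮q p<q)

  ⟪⟫-> : ∀ {m} {p q : Fin m} → q <ᶠ p → ⟪ p , q ⟫ ≡ (-1ℤ , (q , p)) ∷ []
  ⟪⟫-> {p = p} {q} q<p with <-cmp p q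
  ... | tri< _ _ q≮p = ⊥-elim (q≮p q<p)
  ... | tri≈ _ _ q≮p = ⊥-elim (q≮p q<p)
  ... | tri> _ _ _   = refl

  ⟪⟫-refl : ∀ {m} (p : Fin m) → ⟪ p , p ⟫ ≡ []
  ⟪⟫-refl p with <-cmp p p
  ... | tri< p<p _ _ = ⊥-elim (<-irrefl refl p<p)
  ... | tri≈ _ _ _   = refl
  ... | tri> _ _ p<p = ⊥-elim (<-irrefl refl p<p)

coef1-single : ∀ {m} z (σ : Fin m × Fin m) τ → coef1 ((z , σ) ∷ []) τ ≡ z * δ₁ σ τ
coef1-single z σ τ = trans (coef1-∷ z σ [] τ) (+-identityʳ _)

coef1-⟪⟫-< : ∀ {m} {p q : Fin m} → p <ᶠ q → ∀ τ → coef1 ⟪ p , q ⟫ τ ≡ δ₁ (p , q) τ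
coef1-⟪⟫-< {p = p} {q} p<q τ rewrite ⟪⟫-< p<q = trans (coef1-single 1ℤ (p , q) τ) (*-identityˡ _)

coef1-⟪⟫-swap : ∀ {m} (p q : Fin m) τ → coef1 ⟪ q , p ⟫ τ ≡ - coef1 ⟪ p , q ⟫ τ
coef1-⟪⟫-swap p q τ with <-cmp p q
... | tri< p<q _ _ rewrite ⟪⟫-< p<q | ⟪⟫-> p<q | coef1-single 1ℤ (p , q) τ | coef1-single -1ℤ (p , q) τ =
  solve 1 (λ D → con -1ℤ :* D := :- (con 1ℤ :* D)) refl (δ₁ (p , q) τ)
... | tri≈ _ refl _ rewrite ⟪⟫-refl p = refl
... | tri> _ _ q<p rewrite ⟪⟫-< q<p | ⟪⟫-> q<p | coef1-single 1ℤ (q , p) τ | coef1-single -1ℤ (q , p) τ =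
  solve 1 (λ D → con 1ℤ :* D := :- (con -1ℤ :* D)) refl (δ₁ (q , p) τ)

coef0-∂₁-⟪⟫ : ∀ {m} (p q : Fin m) x → coef0 (∂₁ ⟪ p , q ⟫) x ≡ δ q x - δ p x
coef0-∂₁-⟪⟫ p q x with <-cmp p q
... | tri< p<q _ _ rewrite ⟪⟫-< p<q | coef0-∂₁-∷ 1ℤ p q [] x =
  solve 2 (λ Q P → con 1ℤ :* (Q :- P) :+ con 0ℤ := Q :- P) refl (δ q x) (δ p x)
... | tri≈ _ refl _ rewrite ⟪⟫-refl p = sym (+-inverseʳ (δ p x))
... | tri> _ _ q<p rewrite ⟪⟫-> q<p | coef0-∂₁-∷ -1ℤ q p [] x =
  solve 2 (λ Q P → con -1ℤ :* (P :- Q) :+ con 0ℤ := Q :- P) refl (δ q x) (δ p x)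

△ : ∀ {m} → Fin m → Fin m → Fin m → C2 m
△ p q r with <-cmp p q | <-cmp q r | <-cmp p r
... | tri< _ _ _ | tri< _ _ _ | _          = (1ℤ , (p , q , r)) ∷ []
... | tri< _ _ _ | tri> _ _ _ | tri< _ _ _ = (-1ℤ , (p , r , q)) ∷ []
... | tri< _ _ _ | tri> _ _ _ | tri> _ _ _ = (1ℤ , (r , p , q)) ∷ []
... | tri> _ _ _ | tri> _ _ _ | _          = (-1ℤ , (r , q , p)) ∷ []
... | tri> _ _ _ | tri< _ _ _ | tri< _ _ _ = (-1ℤ , (q , p , r)) ∷ []
... | tri> _ _ _ | tri< _ _ _ | tri> _ _ _ = (1ℤ , (q , r , p)) ∷ []
... | _          | _          | _          = []

circuit : ∀ {m} → Fin m → Fin m → Fin m → Fin m × Fin m → ℤ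
circuit p q r τ = coef1 ⟪ p , q ⟫ τ + coef1 ⟪ q , r ⟫ τ + coef1 ⟪ r , p ⟫ τ

circuit-rotate : ∀ {m} (p q r : Fin m) τ → circuit p q r τ ≡ circuit q r p τ
circuit-rotate p q r τ =
  solve 3 (λ A B C → A :+ B :+ C := B :+ C :+ A) refl (coef1 ⟪ p , q ⟫ τ) (coef1 ⟪ q , r ⟫ τ) (coef1 ⟪ r , p ⟫ τ)

circuit-swap : ∀ {m} (p q r : Fin m) τ → circuit q p r τ ≡ - circuit p q r τ
circuit-swap p q r τ
  rewrite coef1-⟪⟫-swap p q τ | coef1-⟪⟫-swap r p τ | coef1-⟪⟫-swap q r τ =
  solve 3 (λ A B C → :- A :+ :- C :+ :- B := :- (A :+ B :+ C))
    refl (coef1 ⟪ p , q ⟫ τ) (coef1 ⟪ q , r ⟫ τ) (coef1 ⟪ r , p ⟫ τ)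

circuit-degenerate₁₂ : ∀ {m} (p r : Fin m) τ → circuit p p r τ ≡ 0ℤ
circuit-degenerate₁₂ p r τ rewrite ⟪⟫-refl p | coef1-⟪⟫-swap r p τ =
  solve 1 (λ A → con 0ℤ :+ :- A :+ A := con 0ℤ) refl (coef1 ⟪ r , p ⟫ τ)

circuit-degenerate₂₃ : ∀ {m} (p q : Fin m) τ → circuit p q q τ ≡ 0ℤ
circuit-degenerate₂₃ p q τ = trans (circuit-rotate p q q τ) (circuit-degenerate₁₂ q p τ)

circuit-degenerate₁₃ : ∀ {m} (p q : Fin m) τ → circuit p q p τ ≡ 0ℤ
circuit-degenerate₁₃ p q τ = trans (circuit-rotate p q p τ) (circuit-degenerate₂₃ q p τ)

circuit-sorted : ∀ {m} {a b c : Fin m} → a <ᶠ b → b <ᶠ c → ∀ ε τ →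
  coef1 (∂₂ ((ε , (a , b , c)) ∷ [])) τ ≡ ε * circuit a b c τ
circuit-sorted {a = a} {b} {c} a<b b<c ε τ
  rewrite coef1-∂₂-∷ ε a b c [] τ | ⟪⟫-< a<b | ⟪⟫-< b<c | ⟪⟫-> (<-trans a<b b<c)
        | coef1-single 1ℤ (a , b) τ | coef1-single 1ℤ (b , c) τ | coef1-single -1ℤ (a , c) τ =
  solve 4 (λ ε AB BC AC → ε :* (BC :- AC :+ AB) :+ con 0ℤ := ε :* (con 1ℤ :* AB :+ con 1ℤ :* BC :+ con -1ℤ :* AC))
    refl ε (δ₁ (a , b) τ) (δ₁ (b , c) τ) (δ₁ (a , c) τ)

coef1-∂₂-△ : ∀ {m} (p q r : Fin m) τ → coef1 (∂₂ (△ p q r)) τ ≡ circuit p q r τ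
coef1-∂₂-△ p q r τ with <-cmp p q | <-cmp q r | <-cmp p r
... | tri< p<q _ _ | tri< q<r _ _ | _ = trans (circuit-sorted p<q q<r 1ℤ τ) (*-identityˡ _)
... | tri< p<q _ _ | tri> _ _ r<q | tri< p<r _ _ = -1*-cancel-neg (circuit-sorted p<r r<q -1ℤ τ) (begin
  circuit p r q τ    ≡⟨ circuit-rotate p r q τ ⟩
  circuit r q p τ    ≡⟨ circuit-swap q r p τ ⟩
  - circuit q r p τ  ≡⟨ cong -_ (circuit-rotate p q r τ) ⟨
  - circuit p q r τ  ∎)
  where open ≡-Reasoning
... | tri< p<q _ _ | tri> _ _ r<q | tri> _ _ r<p = trans (circuit-sorted r<p p<q 1ℤ τ)
  (trans (*-identityˡ _) (sym (trans (circuit-rotate p q r τ) (circuit-rotate q r p τ))))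
... | tri> _ _ q<p | tri> _ _ r<q | _ = -1*-cancel-neg (circuit-sorted r<q q<p -1ℤ τ)
  (trans (circuit-rotate r q p τ) (circuit-swap p q r τ))
... | tri> _ _ q<p | tri< q<r _ _ | tri< p<r _ _ = -1*-cancel-neg (circuit-sorted q<p p<r -1ℤ τ) (circuit-swap p q r τ)
... | tri> _ _ q<p | tri< q<r _ _ | tri> _ _ r<p = trans (circuit-sorted q<r r<p 1ℤ τ)
  (trans (*-identityˡ _) (sym (circuit-rotate p q r τ)))
... | tri≈ _ refl _ | _              | _              = sym (circuit-degenerate₁₂ p r τ)
... | tri< _ _ _    | tri≈ _ refl _  | _              = sym (circuit-degenerate₂₃ p q τ)
... | tri> _ _ _    | tri≈ _ refl _  | _              = sym (circuit-degenerate₂₃ p q τ)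
... | tri< _ _ _    | tri> _ _ _     | tri≈ _ refl _  = sym (circuit-degenerate₁₃ p q τ)
... | tri> _ _ _    | tri< _ _ _     | tri≈ _ refl _  = sym (circuit-degenerate₁₃ p q τ)

Supported₁ : ∀ {m} → Complex m → C1 m → Set
Supported₁ K c = All (λ e → Edge K (proj₂ e)) c

Supported₂ : ∀ {m} → Complex m → C2 m → Set
Supported₂ K d = All (λ t → Tri K (proj₂ t)) d

scale-supported : ∀ {m} {K : Complex m} l {c} → Supported₁ K c → Supported₁ K (scale l c)
scale-supported l = map⁺

scale₂-supported : ∀ {m} {K : Complex m} l {d} → Supported₂ K d → Supported₂ K (scale₂ l d)
scale₂-supported l = map⁺

module _ {m} (H : Graph m) where

  ⟪⟫-supported : ∀ {u p q} → Adj H u p → Adj H u q → Supported₁ (𝒩 H) ⟪ p , q ⟫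
  ⟪⟫-supported {u} {p} {q} up uq with <-cmp p q
  ... | tri< p<q _ _ rewrite ⟪⟫-< p<q = (p<q , u , up ∷ uq ∷ []) ∷ []
  ... | tri≈ _ refl _ rewrite ⟪⟫-refl p = []
  ... | tri> _ _ q<p rewrite ⟪⟫-> q<p = (q<p , u , uq ∷ up ∷ []) ∷ []

  △-supported : ∀ {u p q r} → Adj H u p → Adj H u q → Adj H u r → Supported₂ (𝒩 H) (△ p q r)
  △-supported {u} {p} {q} {r} up uq ur with <-cmp p q | <-cmp q r | <-cmp p r
  ... | tri< p<q _ _ | tri< q<r _ _ | _            = (p<q , q<r , u , up ∷ uq ∷ ur ∷ []) ∷ []
  ... | tri< _ _ _   | tri> _ _ r<q | tri< p<r _ _ = (p<r , r<q , u , up ∷ ur ∷ uq ∷ []) ∷ []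
  ... | tri< p<q _ _ | tri> _ _ _   | tri> _ _ r<p = (r<p , p<q , u , ur ∷ up ∷ uq ∷ []) ∷ []
  ... | tri> _ _ q<p | tri> _ _ r<q | _            = (r<q , q<p , u , ur ∷ uq ∷ up ∷ []) ∷ []
  ... | tri> _ _ q<p | tri< _ _ _   | tri< p<r _ _ = (q<p , p<r , u , uq ∷ up ∷ ur ∷ []) ∷ []
  ... | tri> _ _ _   | tri< q<r _ _ | tri> _ _ r<p = (q<r , r<p , u , uq ∷ ur ∷ up ∷ []) ∷ []
  ... | tri< _ _ _   | tri≈ _ _ _   | _            = []
  ... | tri> _ _ _   | tri≈ _ _ _   | _            = []
  ... | tri≈ _ _ _   | _            | _            = []
  ... | tri< _ _ _   | tri> _ _ _   | tri≈ _ _ _   = []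
  ... | tri> _ _ _   | tri< _ _ _   | tri≈ _ _ _   = []

-- Chain maps induced by vertex maps

module _ {m m'} (f : Fin m → Fin m') where

  pushEdge : Fin m × Fin m → C1 m'
  pushEdge (p , q) = ⟪ f p , f q ⟫

  push₁ : C1 m → C1 m'
  push₁ = extend pushEdge

  push₂ : C2 m → C2 m'
  push₂ = concatMap λ { (z , (p , q , r)) → scale₂ z (△ (f p) (f q) (f r)) }

  coef1-push₁-⟪⟫ : ∀ p q τ → coef1 (push₁ ⟪ p , q ⟫) τ ≡ coef1 ⟪ f p , f q ⟫ τ
  coef1-push₁-⟪⟫ p q τ with <-cmp p q
  ... | tri< p<q _ _ rewrite ⟪⟫-< p<q = trans (coef1-extend-single pushEdge 1ℤ (p , q) τ) (*-identityˡ _)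
  ... | tri≈ _ refl _ rewrite ⟪⟫-refl p | ⟪⟫-refl (f p) = refl
  ... | tri> _ _ q<p rewrite ⟪⟫-> q<p =
    -1*-cancel-neg (coef1-extend-single pushEdge -1ℤ (q , p) τ) (coef1-⟪⟫-swap (f p) (f q) τ)

  coef1-push₁-∂₂ : ∀ d τ → coef1 (push₁ (∂₂ d)) τ ≡ coef1 (∂₂ (push₂ d)) τ
  coef1-push₁-∂₂ [] τ = refl
  coef1-push₁-∂₂ ((z , (p , q , r)) ∷ d) τ = begin
    coef1 (push₁ (faces ++ ∂₂ d)) τ
      ≡⟨ coef1-extend-++ pushEdge faces (∂₂ d) τ ⟩
    coef1 (push₁ faces) τ + coef1 (push₁ (∂₂ d)) τ
      ≡⟨ cong₂ _+_ push₁-faces (coef1-push₁-∂₂ d τ) ⟩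
    z * circuit (f p) (f q) (f r) τ + coef1 (∂₂ (push₂ d)) τ
      ≡⟨ cong (_+ coef1 (∂₂ (push₂ d)) τ) (trans (coef1-∂₂-scale₂ z △f τ) (cong (z *_) (coef1-∂₂-△ (f p) (f q) (f r) τ))) ⟨
    coef1 (∂₂ (scale₂ z △f)) τ + coef1 (∂₂ (push₂ d)) τ
      ≡⟨ coef1-∂₂-++ (scale₂ z △f) (push₂ d) τ ⟨
    coef1 (∂₂ (push₂ ((z , (p , q , r)) ∷ d))) τ ∎
    where
    open ≡-Reasoning
    faces : C1 m
    faces = (z , (q , r)) ∷ (- z , (p , r)) ∷ (z , (p , q)) ∷ []
    △f : C2 m'
    △f = △ (f p) (f q) (f r)
    K : Fin m → Fin m → ℤ
    K s t = coef1 ⟪ f s , f t ⟫ τ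
    push₁-faces : coef1 (push₁ faces) τ ≡ z * circuit (f p) (f q) (f r) τ
    push₁-faces rewrite coef1-extend-∷ pushEdge z (q , r) ((- z , (p , r)) ∷ (z , (p , q)) ∷ []) τ
                      | coef1-extend-∷ pushEdge (- z) (p , r) ((z , (p , q)) ∷ []) τ
                      | coef1-extend-∷ pushEdge z (p , q) [] τ | coef1-⟪⟫-swap (f r) (f p) τ =
      solve 4 (λ z QR RP PQ → z :* QR :+ (:- z :* :- RP :+ (z :* PQ :+ con 0ℤ)) := z :* (PQ :+ QR :+ RP))
        refl z (K q r) (K r p) (K p q)

  push₂-supported : ∀ {G : Graph m} {H : Graph m'} → (∀ {p q} → Adj G p q → Adj H (f p) (f q)) →
    ∀ d → Supported₂ (𝒩 G) d → Supported₂ (𝒩 H) (push₂ d)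
  push₂-supported hom [] [] = []
  push₂-supported {H = H} hom ((z , _) ∷ d) ((_ , _ , u , up ∷ uq ∷ ur ∷ []) ∷ ds) =
    ++⁺ (scale₂-supported {K = 𝒩 H} z (△-supported H (hom up) (hom uq) (hom ur))) (push₂-supported hom d ds)

sum-concat-tabulate : ∀ {X : Set} (Φ : List X → ℤ) → Φ [] ≡ 0ℤ → (∀ c d → Φ (c ++ d) ≡ Φ c + Φ d) →
  ∀ {k} (F : Fin k → List X) → Φ (concat (tabulate F)) ≡ sum (Φ ∘ F)
sum-concat-tabulate Φ Φ[] Φ++ {zero}  F = Φ[]
sum-concat-tabulate Φ Φ[] Φ++ {suc k} F =
  trans (Φ++ (F zero) _) (cong (Φ (F zero) +_) (sum-concat-tabulate Φ Φ[] Φ++ (F ∘ suc)))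

linear-lincomb : ∀ {m k} (Φ : C1 m → ℤ) → Φ [] ≡ 0ℤ → (∀ c d → Φ (c ++ d) ≡ Φ c + Φ d) →
  (∀ l c → Φ (scale l c) ≡ l * Φ c) →
  ∀ (l : Fin k → ℤ) zs → Φ (lincomb l zs) ≡ sum λ i → l i * Φ (zs i)
linear-lincomb {m} {k} Φ Φ[] Φ++ Φscale l zs = begin
  Φ (concat (map F (allFin _)))  ≡⟨ cong (Φ ∘ concat) (map-tabulate id F) ⟩
  Φ (concat (tabulate F))        ≡⟨ sum-concat-tabulate Φ Φ[] Φ++ F ⟩
  sum (Φ ∘ F)                    ≡⟨ sum-cong-≗ (λ i → Φscale (l i) (zs i)) ⟩
  sum (λ i → l i * Φ (zs i))     ∎
  where
  open ≡-Reasoning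
  F : Fin k → C1 m
  F = λ i → scale (l i) (zs i)

coef1-lincomb : ∀ {m k} (l : Fin k → ℤ) (zs : Fin k → C1 m) τ →
  coef1 (lincomb l zs) τ ≡ sum λ i → l i * coef1 (zs i) τ
coef1-lincomb l zs τ =
  linear-lincomb (λ c → coef1 c τ) refl (λ c d → coef1-++ c d τ) (λ l c → coef1-scale l c τ) l zs

coef1-push₁-lincomb : ∀ {m m' k} (f : Fin m → Fin m') (l : Fin k → ℤ) (zs : Fin k → C1 m) τ →
  coef1 (push₁ f (lincomb l zs)) τ ≡ sum λ i → l i * coef1 (push₁ f (zs i)) τ
coef1-push₁-lincomb f l zs τ =
  linear-lincomb (λ c → coef1 (push₁ f c) τ) refl (λ c d → coef1-extend-++ (pushEdge f) c d τ)
    (λ l c → coef1-extend-scale (pushEdge f) l c τ) l zs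

lincomb₂ : ∀ {m k} → (Fin k → ℤ) → (Fin k → C2 m) → C2 m
lincomb₂ {k = k} l ds = concat (map (λ i → scale₂ (l i) (ds i)) (allFin k))

coef1-∂₂-lincomb₂ : ∀ {m k} (l : Fin k → ℤ) (ds : Fin k → C2 m) τ →
  coef1 (∂₂ (lincomb₂ l ds)) τ ≡ sum λ i → l i * coef1 (∂₂ (ds i)) τ
coef1-∂₂-lincomb₂ {m} {k} l ds τ = begin
  Φ (concat (map F (allFin _)))  ≡⟨ cong (Φ ∘ concat) (map-tabulate id F) ⟩
  Φ (concat (tabulate F))        ≡⟨ sum-concat-tabulate Φ refl (λ c d → coef1-∂₂-++ c d τ) F ⟩
  sum (Φ ∘ F)                    ≡⟨ sum-cong-≗ (λ i → coef1-∂₂-scale₂ (l i) (ds i) τ) ⟩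
  sum (λ i → l i * Φ (ds i))     ∎
  where
  open ≡-Reasoning
  Φ : C2 m → ℤ
  Φ = λ d → coef1 (∂₂ d) τ
  F : Fin k → C2 m
  F = λ i → scale₂ (l i) (ds i)

lincomb₂-supported : ∀ {m k} {K : Complex m} (l : Fin k → ℤ) ds → (∀ i → Supported₂ K (ds i)) →
  Supported₂ K (lincomb₂ l ds)
lincomb₂-supported {K = K} l ds ds-supp rewrite map-tabulate id (λ i → scale₂ (l i) (ds i)) =
  concat⁺ (tabulate⁺ λ i → scale₂-supported {K = K} (l i) (ds-supp i))

-- Lifting cycles along a collapse

δ-punchIn : ∀ {m} (w : Fin (suc m)) a b → δ (punchIn w a) (punchIn w b) ≡ δ a b
δ-punchIn w a b with a ≟ b
... | yes refl = cong (if_then 1ℤ else 0ℤ) (dec-true (punchIn w a ≟ punchIn w a) refl)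
... | no a≢b   = cong (if_then 1ℤ else 0ℤ) (dec-false (punchIn w a ≟ punchIn w b) (a≢b ∘ punchIn-injective w a b))

δ-punchIn-pivot : ∀ {m} (w : Fin (suc m)) a → δ (punchIn w a) w ≡ 0ℤ
δ-punchIn-pivot w a = cong (if_then 1ℤ else 0ℤ) (dec-false (punchIn w a ≟ w) (punchInᵢ≢i w a))

module Transfer {n} {G : Graph (suc n)} {H : Graph n} (w : Fin (suc n)) (f : Fin (suc n) → Fin n)
                (hom : ∀ {p q} → Adj G p q → Adj H (f p) (f q)) where

  record Lift (x y : Fin n) : Set where
    field
      path              : C1 (suc n)
      filling           : C2 n
      path-supported    : Supported₁ (𝒩 G) path
      filling-supported : Supported₂ (𝒩 H) filling
      coef0-∂₁-path     : ∀ q → coef0 (∂₁ path) q ≡ δ (punchIn w y) q - δ (punchIn w x) q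
      coef1-push₁-path  : ∀ τ → coef1 (push₁ f path) τ ≡ coef1 ⟪ x , y ⟫ τ + coef1 (∂₂ filling) τ

  module _ (lift : ∀ {u x y} → Adj H u x → Adj H u y → Lift x y) where
    open Lift

    lift₁ : (c : C1 n) → Supported₁ (𝒩 H) c → C1 (suc n)
    lift₁ []                  []                             = []
    lift₁ ((z , (x , y)) ∷ c) ((_ , _ , ux ∷ uy ∷ []) ∷ cs) = scale z (path (lift ux uy)) ++ lift₁ c cs

    filling₁ : (c : C1 n) → Supported₁ (𝒩 H) c → C2 n
    filling₁ []                  []                             = []
    filling₁ ((z , (x , y)) ∷ c) ((_ , _ , ux ∷ uy ∷ []) ∷ cs) = scale₂ z (filling (lift ux uy)) ++ filling₁ c cs

    lift₁-supported : ∀ c cs → Supported₁ (𝒩 G) (lift₁ c cs)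
    lift₁-supported []                  []                             = []
    lift₁-supported ((z , (x , y)) ∷ c) ((_ , _ , ux ∷ uy ∷ []) ∷ cs) =
      ++⁺ (scale-supported {K = 𝒩 G} z (path-supported (lift ux uy))) (lift₁-supported c cs)

    filling₁-supported : ∀ c cs → Supported₂ (𝒩 H) (filling₁ c cs)
    filling₁-supported []                  []                             = []
    filling₁-supported ((z , (x , y)) ∷ c) ((_ , _ , ux ∷ uy ∷ []) ∷ cs) =
      ++⁺ (scale₂-supported {K = 𝒩 H} z (filling-supported (lift ux uy))) (filling₁-supported c cs)

    coef0-∂₁-lift₁-punchIn : ∀ c cs y₀ → coef0 (∂₁ (lift₁ c cs)) (punchIn w y₀) ≡ coef0 (∂₁ c) y₀
    coef0-∂₁-lift₁-punchIn []                  []                             y₀ = refl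
    coef0-∂₁-lift₁-punchIn ((z , (x , y)) ∷ c) ((_ , _ , ux ∷ uy ∷ []) ∷ cs) y₀ = begin
      coef0 (∂₁ (scale z P ++ lift₁ c cs)) q
        ≡⟨ coef0-∂₁-++ (scale z P) (lift₁ c cs) q ⟩
      coef0 (∂₁ (scale z P)) q + coef0 (∂₁ (lift₁ c cs)) q
        ≡⟨ cong₂ _+_ (coef0-∂₁-scale z P q) (coef0-∂₁-lift₁-punchIn c cs y₀) ⟩
      z * coef0 (∂₁ P) q + coef0 (∂₁ c) y₀
        ≡⟨ cong (λ r → z * r + coef0 (∂₁ c) y₀)
             (trans (coef0-∂₁-path (lift ux uy) q) (cong₂ _-_ (δ-punchIn w y y₀) (δ-punchIn w x y₀))) ⟩
      z * (δ y y₀ - δ x y₀) + coef0 (∂₁ c) y₀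
        ≡⟨ coef0-∂₁-∷ z x y c y₀ ⟨
      coef0 (∂₁ ((z , (x , y)) ∷ c)) y₀ ∎
      where
      open ≡-Reasoning
      P : C1 (suc n)
      P = path (lift ux uy)
      q : Fin (suc n)
      q = punchIn w y₀

    coef0-∂₁-lift₁-pivot : ∀ c cs → coef0 (∂₁ (lift₁ c cs)) w ≡ 0ℤ
    coef0-∂₁-lift₁-pivot []                  []                             = refl
    coef0-∂₁-lift₁-pivot ((z , (x , y)) ∷ c) ((_ , _ , ux ∷ uy ∷ []) ∷ cs) = begin
      coef0 (∂₁ (scale z P ++ lift₁ c cs)) w
        ≡⟨ coef0-∂₁-++ (scale z P) (lift₁ c cs) w ⟩
      coef0 (∂₁ (scale z P)) w + coef0 (∂₁ (lift₁ c cs)) w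
        ≡⟨ cong₂ _+_ (coef0-∂₁-scale z P w) (coef0-∂₁-lift₁-pivot c cs) ⟩
      z * coef0 (∂₁ P) w + 0ℤ
        ≡⟨ cong (λ r → z * r + 0ℤ)
             (trans (coef0-∂₁-path (lift ux uy) w) (cong₂ _-_ (δ-punchIn-pivot w y) (δ-punchIn-pivot w x))) ⟩
      z * 0ℤ + 0ℤ
        ≡⟨ trans (+-identityʳ _) (*-zeroʳ z) ⟩
      0ℤ ∎
      where
      open ≡-Reasoning
      P : C1 (suc n)
      P = path (lift ux uy)

    lift₁-cycle : ∀ c cs → IsCycle₁ (𝒩 H) c → IsCycle₁ (𝒩 G) (lift₁ c cs)
    lift₁-cycle c cs (_ , ∂c≡0) = lift₁-supported c cs , ∂lift≡0
      where
      ∂lift≡0 : ∀ q → coef0 (∂₁ (lift₁ c cs)) q ≡ 0ℤ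
      ∂lift≡0 q with w ≟ q
      ... | yes refl = coef0-∂₁-lift₁-pivot c cs
      ... | no w≢q   = subst (λ r → coef0 (∂₁ (lift₁ c cs)) r ≡ 0ℤ) (punchIn-punchOut w≢q)
                         (trans (coef0-∂₁-lift₁-punchIn c cs (punchOut w≢q)) (∂c≡0 (punchOut w≢q)))

    coef1-push₁-lift₁ : ∀ c cs τ → coef1 (push₁ f (lift₁ c cs)) τ ≡ coef1 c τ + coef1 (∂₂ (filling₁ c cs)) τ
    coef1-push₁-lift₁ []                  []                             τ = refl
    coef1-push₁-lift₁ ((z , (x , y)) ∷ c) ((x<y , _ , ux ∷ uy ∷ []) ∷ cs) τ = begin
      coef1 (push₁ f (scale z P ++ lift₁ c cs)) τ
        ≡⟨ coef1-extend-++ (pushEdge f) (scale z P) (lift₁ c cs) τ ⟩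
      coef1 (push₁ f (scale z P)) τ + coef1 (push₁ f (lift₁ c cs)) τ
        ≡⟨ cong₂ _+_ (coef1-extend-scale (pushEdge f) z P τ) (coef1-push₁-lift₁ c cs τ) ⟩
      z * coef1 (push₁ f P) τ + (coef1 c τ + coef1 (∂₂ (filling₁ c cs)) τ)
        ≡⟨ cong (λ r → z * r + (coef1 c τ + coef1 (∂₂ (filling₁ c cs)) τ))
             (trans (coef1-push₁-path (lift ux uy) τ) (cong (_+ coef1 (∂₂ F) τ) (coef1-⟪⟫-< x<y τ))) ⟩
      z * (δ₁ (x , y) τ + coef1 (∂₂ F) τ) + (coef1 c τ + coef1 (∂₂ (filling₁ c cs)) τ)
        ≡⟨ solve 5 (λ z D B C E → z :* (D :+ B) :+ (C :+ E) := (z :* D :+ C) :+ (z :* B :+ E))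
             refl z (δ₁ (x , y) τ) (coef1 (∂₂ F) τ) (coef1 c τ) (coef1 (∂₂ (filling₁ c cs)) τ) ⟩
      (z * δ₁ (x , y) τ + coef1 c τ) + (z * coef1 (∂₂ F) τ + coef1 (∂₂ (filling₁ c cs)) τ)
        ≡⟨ cong₂ _+_ (coef1-∷ z (x , y) c τ)
             (trans (coef1-∂₂-++ (scale₂ z F) (filling₁ c cs) τ)
                    (cong (_+ coef1 (∂₂ (filling₁ c cs)) τ) (coef1-∂₂-scale₂ z F τ))) ⟨
      coef1 ((z , (x , y)) ∷ c) τ + coef1 (∂₂ (scale₂ z F ++ filling₁ c cs)) τ ∎
      where
      open ≡-Reasoning
      P : C1 (suc n)
      P = path (lift ux uy)
      F : C2 n
      F = filling (lift ux uy)

    module _ {k} (zs : Fin k → C1 n) (supp : ∀ i → Supported₁ (𝒩 H) (zs i)) where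

      lifted : Fin k → C1 (suc n)
      lifted i = lift₁ (zs i) (supp i)

      fillings : Fin k → C2 n
      fillings i = filling₁ (zs i) (supp i)

      boundary-descends : ∀ l → IsBoundary₁ (𝒩 G) (lincomb l lifted) → IsBoundary₁ (𝒩 H) (lincomb l zs)
      boundary-descends l (d , d-supp , ∂d≈) = d' , d'-supp , ∂d'≈
        where
        d' : C2 n
        d' = push₂ f d ++ scale₂ -1ℤ (lincomb₂ l fillings)

        d'-supp : Supported₂ (𝒩 H) d'
        d'-supp = ++⁺ (push₂-supported f hom d d-supp)
          (scale₂-supported {K = 𝒩 H} -1ℤ (lincomb₂-supported {K = 𝒩 H} l fillings (λ i → filling₁-supported (zs i) (supp i))))

        ∂d'≈ : ∂₂ d' ≈₁ lincomb l zs
        ∂d'≈ τ = begin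
          coef1 (∂₂ d') τ
            ≡⟨ coef1-∂₂-++ (push₂ f d) (scale₂ -1ℤ (lincomb₂ l fillings)) τ ⟩
          coef1 (∂₂ (push₂ f d)) τ + coef1 (∂₂ (scale₂ -1ℤ (lincomb₂ l fillings))) τ
            ≡⟨ cong₂ _+_ (sym (coef1-push₁-∂₂ f d τ)) (coef1-∂₂-scale₂ -1ℤ (lincomb₂ l fillings) τ) ⟩
          coef1 (push₁ f (∂₂ d)) τ + -1ℤ * coef1 (∂₂ (lincomb₂ l fillings)) τ
            ≡⟨ cong₂ (λ a b → a + -1ℤ * b)
                 (trans (extend-resp-≈₁ (pushEdge f) {∂₂ d} {lincomb l lifted} ∂d≈ τ) (coef1-push₁-lincomb f l lifted τ))
                 (coef1-∂₂-lincomb₂ l fillings τ) ⟩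
          sum (λ i → l i * coef1 (push₁ f (lifted i)) τ) + -1ℤ * ΣF
            ≡⟨ cong (_+ -1ℤ * ΣF) (sum-cong-≗ λ i →
                 trans (cong (l i *_) (coef1-push₁-lift₁ (zs i) (supp i) τ)) (*-distribˡ-+ (l i) _ _)) ⟩
          sum (λ i → l i * coef1 (zs i) τ + l i * coef1 (∂₂ (fillings i)) τ) + -1ℤ * ΣF
            ≡⟨ cong (_+ -1ℤ * ΣF) (∑-distrib-+ (λ i → l i * coef1 (zs i) τ) _) ⟩
          ΣZ + ΣF + -1ℤ * ΣF
            ≡⟨ solve 2 (λ Z F → Z :+ F :+ con -1ℤ :* F := Z) refl ΣZ ΣF ⟩
          ΣZ
            ≡⟨ coef1-lincomb l zs τ ⟨
          coef1 (lincomb l zs) τ ∎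
          where
          open ≡-Reasoning
          ΣZ ΣF : ℤ
          ΣZ = sum λ i → l i * coef1 (zs i) τ
          ΣF = sum λ i → l i * coef1 (∂₂ (fillings i)) τ

    rank-transfer : H1Rank≤ (𝒩 H) (𝒩 G)
    rank-transfer k (zs , cycles , independent) =
      lifted zs supp ,
      (λ i → lift₁-cycle (zs i) (supp i) (cycles i)) ,
      (λ l → independent l ∘ boundary-descends zs supp l)
      where
      supp : ∀ i → Supported₁ (𝒩 H) (zs i)
      supp i = proj₁ (cycles i)

-- Vertex identification

eqb⇒≡ : ∀ {m} {a b : Fin m} → T (eqb a b) → a ≡ b
eqb⇒≡ {a = a} {b} t with a ≟ b
... | yes a≡b = a≡b
... | no _    = ⊥-elim t

≡⇒eqb : ∀ {m} {a b : Fin m} → a ≡ b → T (eqb a b)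
≡⇒eqb {a = a} refl = Equivalence.from T-≡ (dec-true (a ≟ a) refl)

module Identification {n} (G : Graph (suc n)) (v w : Fin (suc n)) (v≢w : v ≢ w) where

  G' : Graph n
  G' = vid G v w

  v' : Fin n
  v' = punchOut (v≢w ∘ sym)

  punchIn-v' : punchIn w v' ≡ v
  punchIn-v' = punchIn-punchOut (v≢w ∘ sym)

  collapse : Fin (suc n) → Fin n
  collapse p with w ≟ p
  ... | yes _   = v'
  ... | no w≢p  = punchOut w≢p

  collapse-punchIn : ∀ x → collapse (punchIn w x) ≡ x
  collapse-punchIn x with w ≟ punchIn w x
  ... | yes w≡x = ⊥-elim (punchInᵢ≢i w x (sym w≡x))
  ... | no w≢x  = trans (punchOut-cong w refl) (punchOut-punchIn w)

  collapse-pivot : collapse w ≡ v'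
  collapse-pivot with w ≟ w
  ... | yes _   = refl
  ... | no w≢w  = ⊥-elim (w≢w refl)

  collapse-v : collapse v ≡ v'
  collapse-v = trans (cong collapse (sym punchIn-v')) (collapse-punchIn v')

  punchIn-collapse : ∀ {p} → p ≢ w → punchIn w (collapse p) ≡ p
  punchIn-collapse {p} p≢w with w ≟ p
  ... | yes w≡p = ⊥-elim (p≢w (sym w≡p))
  ... | no w≢p  = punchIn-punchOut w≢p

  vid-adj⇒ : ∀ {x y} → Adj G' x y →
    Adj G (punchIn w x) (punchIn w y) ⊎
    (punchIn w x ≡ v × Adj G w (punchIn w y)) ⊎
    (punchIn w y ≡ v × Adj G (punchIn w x) w)
  vid-adj⇒ xy with Equivalence.to T-∨ xy
  ... | inj₁ inherited = inj₁ inherited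
  ... | inj₂ merged with Equivalence.to T-∨ merged
  ...   | inj₁ left  = let (x≡v , wy) = Equivalence.to T-∧ left in inj₂ (inj₁ (eqb⇒≡ x≡v , wy))
  ...   | inj₂ right = let (y≡v , xw) = Equivalence.to T-∧ right in inj₂ (inj₂ (eqb⇒≡ y≡v , xw))

  vid-adj-inherit : ∀ {x y} → Adj G (punchIn w x) (punchIn w y) → Adj G' x y
  vid-adj-inherit {x} {y} xy = Equivalence.from (T-∨ {G (punchIn w x) (punchIn w y)}) (inj₁ xy)

  vid-adj-left : ∀ {x y} → punchIn w x ≡ v → Adj G w (punchIn w y) → Adj G' x y
  vid-adj-left {x} {y} x≡v wy = Equivalence.from (T-∨ {G (punchIn w x) (punchIn w y)})
    (inj₂ (Equivalence.from (T-∨ {eqb (punchIn w x) v ∧ G w (punchIn w y)})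
      (inj₁ (Equivalence.from T-∧ (≡⇒eqb x≡v , wy)))))

  vid-adj-right : ∀ {x y} → punchIn w y ≡ v → Adj G (punchIn w x) w → Adj G' x y
  vid-adj-right {x} {y} y≡v xw = Equivalence.from (T-∨ {G (punchIn w x) (punchIn w y)})
    (inj₂ (Equivalence.from (T-∨ {eqb (punchIn w x) v ∧ G w (punchIn w y)})
      (inj₂ (Equivalence.from T-∧ (≡⇒eqb y≡v , xw)))))

  punchIn-collapse-pivot : punchIn w (collapse w) ≡ v
  punchIn-collapse-pivot = trans (cong (punchIn w) collapse-pivot) punchIn-v'

  collapse-hom : (∀ p → ¬ Adj G p p) → ∀ {p q} → Adj G p q → Adj G' (collapse p) (collapse q)
  collapse-hom loopless {p} {q} pq with p ≟ w | q ≟ w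
  ... | yes refl | yes refl = ⊥-elim (loopless w pq)
  ... | yes refl | no q≢w   = vid-adj-left punchIn-collapse-pivot (subst (Adj G w) (sym (punchIn-collapse q≢w)) pq)
  ... | no p≢w   | yes refl = vid-adj-right punchIn-collapse-pivot (subst (λ r → Adj G r w) (sym (punchIn-collapse p≢w)) pq)
  ... | no p≢w   | no q≢w   = vid-adj-inherit (subst₂ (Adj G) (sym (punchIn-collapse p≢w)) (sym (punchIn-collapse q≢w)) pq)

-- Identifying the ends of a path of length four

module LengthFourPath {n} (G : Graph (suc n)) (v w : Fin (suc n)) (simple : IsSimple G)
                      (dist : DistAtLeast G 3 v w) (path : Path G 4 v w) where

  adj-sym : ∀ {p q} → Adj G p q → Adj G q p
  adj-sym {p} {q} = subst T (proj₁ simple p q)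

  loopless : ∀ p → ¬ Adj G p p
  loopless p = subst T (proj₂ simple p)

  v≢w : v ≢ w
  v≢w v≡w = dist 0 (s≤s z≤n) (v ∷ [] , refl , v≡w , λ ())

  v≁w : ¬ Adj G v w
  v≁w v~w = dist 1 (s≤s (s≤s z≤n)) (v ∷ w ∷ [] , refl , refl , λ { zero → v~w })

  open Identification G v w v≢w
  open Transfer {G = G} {H = G'} w collapse (collapse-hom loopless) public

  a b c : Fin (suc n)
  a = lookup (proj₁ path) (suc zero)
  b = lookup (proj₁ path) (suc (suc zero))
  c = lookup (proj₁ path) (suc (suc (suc zero)))

  v~a : Adj G v a
  v~a = subst (λ p → Adj G p a) (proj₁ (proj₂ path)) (proj₁ (proj₂ (proj₂ (proj₂ path))) zero)

  a~b : Adj G a b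
  a~b = proj₁ (proj₂ (proj₂ (proj₂ path))) (suc zero)

  b~c : Adj G b c
  b~c = proj₁ (proj₂ (proj₂ (proj₂ path))) (suc (suc zero))

  c~w : Adj G c w
  c~w = subst (Adj G c) (proj₁ (proj₂ (proj₂ path))) (proj₁ (proj₂ (proj₂ (proj₂ path))) (suc (suc (suc zero))))

  a≢w : a ≢ w
  a≢w a≡w = v≁w (subst (Adj G v) a≡w v~a)

  c≢w : c ≢ w
  c≢w c≡w = loopless c (subst (Adj G c) (sym c≡w) c~w)

  record Anchor (u x : Fin n) : Set where
    field
      end                : Fin (suc n)
      detour             : C1 (suc n)
      u~end              : Adj G (punchIn w u) end
      collapse-end       : collapse end ≡ x
      detour-supported   : Supported₁ (𝒩 G) detour
      coef0-∂₁-detour    : ∀ q → coef0 (∂₁ detour) q ≡ δ end q - δ (punchIn w x) q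
      coef1-push₁-detour : ∀ τ → coef1 (push₁ collapse detour) τ ≡ 0ℤ

  anchor : ∀ {u x} → u ≢ v' → Adj G' u x → Anchor u x
  anchor {u} {x} u≢v' ux with vid-adj⇒ ux
  ... | inj₁ inherited = record
    { end                = punchIn w x
    ; detour             = []
    ; u~end              = inherited
    ; collapse-end       = collapse-punchIn x
    ; detour-supported   = []
    ; coef0-∂₁-detour    = λ q → sym (+-inverseʳ (δ (punchIn w x) q))
    ; coef1-push₁-detour = λ _ → refl
    }
  ... | inj₂ (inj₁ (u≡v , _)) = ⊥-elim (u≢v' (punchIn-injective w u v' (trans u≡v (sym punchIn-v'))))
  ... | inj₂ (inj₂ (x≡v , u~w)) = record
    { end                = w
    ; detour             = ⟪ v , b ⟫ ++ ⟪ b , w ⟫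
    ; u~end              = u~w
    ; collapse-end       = trans collapse-pivot (punchIn-injective w v' x (trans punchIn-v' (sym x≡v)))
    ; detour-supported   = ++⁺ (⟪⟫-supported G (adj-sym v~a) a~b) (⟪⟫-supported G (adj-sym b~c) c~w)
    ; coef0-∂₁-detour    = ∂detour
    ; coef1-push₁-detour = push₁-detour
    }
    where
    ∂detour : ∀ q → coef0 (∂₁ (⟪ v , b ⟫ ++ ⟪ b , w ⟫)) q ≡ δ w q - δ (punchIn w x) q
    ∂detour q rewrite x≡v | coef0-∂₁-++ ⟪ v , b ⟫ ⟪ b , w ⟫ q | coef0-∂₁-⟪⟫ v b q | coef0-∂₁-⟪⟫ b w q =
      solve 3 (λ B V W → B :- V :+ (W :- B) := W :- V) refl (δ b q) (δ v q) (δ w q)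

    push₁-detour : ∀ τ → coef1 (push₁ collapse (⟪ v , b ⟫ ++ ⟪ b , w ⟫)) τ ≡ 0ℤ
    push₁-detour τ rewrite coef1-extend-++ (pushEdge collapse) ⟪ v , b ⟫ ⟪ b , w ⟫ τ
                         | coef1-push₁-⟪⟫ collapse v b τ | coef1-push₁-⟪⟫ collapse b w τ
                         | collapse-v | collapse-pivot | coef1-⟪⟫-swap v' (collapse b) τ =
      +-inverseʳ (coef1 ⟪ v' , collapse b ⟫ τ)

  lift-away-from-v' : ∀ {u x y} → u ≢ v' → Adj G' u x → Adj G' u y → Lift x y
  lift-away-from-v' {u} {x} {y} u≢v' ux uy = record
    { path              = P
    ; filling           = []
    ; path-supported    = ++⁺ (detour-supported X)
                            (++⁺ (⟪⟫-supported G (u~end X) (u~end Y)) (scale-supported {K = 𝒩 G} -1ℤ (detour-supported Y)))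
    ; filling-supported = []
    ; coef0-∂₁-path     = ∂P
    ; coef1-push₁-path  = push₁-P
    }
    where
    X : Anchor u x
    X = anchor u≢v' ux
    Y : Anchor u y
    Y = anchor u≢v' uy
    open Anchor

    P : C1 (suc n)
    P = detour X ++ (⟪ end X , end Y ⟫ ++ scale -1ℤ (detour Y))

    ∂P : ∀ q → coef0 (∂₁ P) q ≡ δ (punchIn w y) q - δ (punchIn w x) q
    ∂P q rewrite coef0-∂₁-++ (detour X) (⟪ end X , end Y ⟫ ++ scale -1ℤ (detour Y)) q
               | coef0-∂₁-++ ⟪ end X , end Y ⟫ (scale -1ℤ (detour Y)) q
               | coef0-∂₁-scale -1ℤ (detour Y) q
               | coef0-∂₁-detour X q | coef0-∂₁-⟪⟫ (end X) (end Y) q | coef0-∂₁-detour Y q =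
      solve 4 (λ EX IX EY IY → EX :- IX :+ (EY :- EX :+ con -1ℤ :* (EY :- IY)) := IY :- IX)
        refl (δ (end X) q) (δ (punchIn w x) q) (δ (end Y) q) (δ (punchIn w y) q)

    push₁-P : ∀ τ → coef1 (push₁ collapse P) τ ≡ coef1 ⟪ x , y ⟫ τ + coef1 (∂₂ []) τ
    push₁-P τ rewrite coef1-extend-++ (pushEdge collapse) (detour X) (⟪ end X , end Y ⟫ ++ scale -1ℤ (detour Y)) τ
                    | coef1-extend-++ (pushEdge collapse) ⟪ end X , end Y ⟫ (scale -1ℤ (detour Y)) τ
                    | coef1-extend-scale (pushEdge collapse) -1ℤ (detour Y) τ
                    | coef1-push₁-detour X τ | coef1-push₁-detour Y τ
                    | coef1-push₁-⟪⟫ collapse (end X) (end Y) τ | collapse-end X | collapse-end Y =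
      solve 1 (λ E → con 0ℤ :+ (E :+ con -1ℤ :* con 0ℤ) := E :+ con 0ℤ) refl (coef1 ⟪ x , y ⟫ τ)

  record Spoke (x : Fin n) : Set where
    field
      hub spoke   : Fin (suc n)
      hub~x       : Adj G hub (punchIn w x)
      hub~spoke   : Adj G hub spoke
      b~spoke     : Adj G b spoke
      v'~spoke    : Adj G' v' (collapse spoke)

  spoke-at : ∀ {x} → Adj G' v' x → Spoke x
  spoke-at {x} v'x with vid-adj⇒ v'x
  ... | inj₁ inherited = record
    { hub = v ; spoke = a
    ; hub~x     = subst (λ p → Adj G p (punchIn w x)) punchIn-v' inherited
    ; hub~spoke = v~a
    ; b~spoke   = adj-sym a~b
    ; v'~spoke  = vid-adj-inherit (subst₂ (Adj G) (sym punchIn-v') (sym (punchIn-collapse a≢w)) v~a)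
    }
  ... | inj₂ (inj₁ (_ , w~x)) = record
    { hub = w ; spoke = c
    ; hub~x     = w~x
    ; hub~spoke = adj-sym c~w
    ; b~spoke   = b~c
    ; v'~spoke  = vid-adj-left punchIn-v' (subst (Adj G w) (sym (punchIn-collapse c≢w)) (adj-sym c~w))
    }
  ... | inj₂ (inj₂ (_ , v~w)) = ⊥-elim (v≁w (subst (λ p → Adj G p w) punchIn-v' v~w))

  lift-at-v' : ∀ {x y} → Adj G' v' x → Adj G' v' y → Lift x y
  lift-at-v' {x} {y} v'x v'y = record
    { path              = P
    ; filling           = F
    ; path-supported    = ++⁺ (⟪⟫-supported G (hub~x X) (hub~spoke X))
                            (++⁺ (⟪⟫-supported G (b~spoke X) (b~spoke Y)) (⟪⟫-supported G (hub~spoke Y) (hub~x Y)))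
    ; filling-supported = ++⁺ (△-supported G' v'x (v'~spoke X) (v'~spoke Y)) (△-supported G' v'x (v'~spoke Y) v'y)
    ; coef0-∂₁-path     = ∂P
    ; coef1-push₁-path  = push₁-P
    }
    where
    X : Spoke x
    X = spoke-at v'x
    Y : Spoke y
    Y = spoke-at v'y
    open Spoke
    sX sY : Fin (suc n)
    sX = spoke X
    sY = spoke Y
    s̄X s̄Y : Fin n
    s̄X = collapse sX
    s̄Y = collapse sY

    P : C1 (suc n)
    P = ⟪ punchIn w x , sX ⟫ ++ (⟪ sX , sY ⟫ ++ ⟪ sY , punchIn w y ⟫)

    F : C2 n
    F = △ x s̄X s̄Y ++ △ x s̄Y y

    ∂P : ∀ q → coef0 (∂₁ P) q ≡ δ (punchIn w y) q - δ (punchIn w x) q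
    ∂P q rewrite coef0-∂₁-++ ⟪ punchIn w x , sX ⟫ (⟪ sX , sY ⟫ ++ ⟪ sY , punchIn w y ⟫) q
               | coef0-∂₁-++ ⟪ sX , sY ⟫ ⟪ sY , punchIn w y ⟫ q
               | coef0-∂₁-⟪⟫ (punchIn w x) sX q | coef0-∂₁-⟪⟫ sX sY q | coef0-∂₁-⟪⟫ sY (punchIn w y) q =
      solve 4 (λ I S T J → S :- I :+ (T :- S :+ (J :- T)) := J :- I)
        refl (δ (punchIn w x) q) (δ sX q) (δ sY q) (δ (punchIn w y) q)

    push₁-P : ∀ τ → coef1 (push₁ collapse P) τ ≡ coef1 ⟪ x , y ⟫ τ + coef1 (∂₂ F) τ
    push₁-P τ rewrite coef1-extend-++ (pushEdge collapse) ⟪ punchIn w x , sX ⟫ (⟪ sX , sY ⟫ ++ ⟪ sY , punchIn w y ⟫) τ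
                    | coef1-extend-++ (pushEdge collapse) ⟪ sX , sY ⟫ ⟪ sY , punchIn w y ⟫ τ
                    | coef1-push₁-⟪⟫ collapse (punchIn w x) sX τ | coef1-push₁-⟪⟫ collapse sX sY τ
                    | coef1-push₁-⟪⟫ collapse sY (punchIn w y) τ
                    | collapse-punchIn x | collapse-punchIn y
                    | coef1-∂₂-++ (△ x s̄X s̄Y) (△ x s̄Y y) τ
                    | coef1-∂₂-△ x s̄X s̄Y τ | coef1-∂₂-△ x s̄Y y τ =
      trans (solve 5 (λ A B C D E → A :+ (B :+ C) := D :+ (A :+ B :+ :- E :+ (E :+ C :+ :- D))) refl A B C D E)
            (sym (cong₂ (λ p q → D + (A + B + p + (E + C + q))) (coef1-⟪⟫-swap x s̄Y τ) (coef1-⟪⟫-swap x y τ)))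
      where
      A B C D E : ℤ
      A = coef1 ⟪ x , s̄X ⟫ τ
      B = coef1 ⟪ s̄X , s̄Y ⟫ τ
      C = coef1 ⟪ s̄Y , y ⟫ τ
      D = coef1 ⟪ x , y ⟫ τ
      E = coef1 ⟪ x , s̄Y ⟫ τ

  lift : ∀ {u x y} → Adj G' u x → Adj G' u y → Lift x y
  lift {u} ux uy with u ≟ v'
  ... | yes refl = lift-at-v' ux uy
  ... | no u≢v'  = lift-away-from-v' u≢v' ux uy

theorem4p2 : ∀ {n} (G : Graph (suc n)) (v w : Fin (suc n)) →
    IsSimple G → DistAtLeast G 3 v w → Path G 4 v w →
    H1Rank≤ (𝒩 (vid G v w)) (𝒩 G)
theorem4p2 G v w simple dist path = rank-transfer lift
  where open LengthFourPath G v w simple dist path
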